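{- Let $M$ and $N$ be matroids on disjoint finite sets $S$ and $T$, and let $A\subseteq S$, $B\subseteq T$. Then \[(M,N;A,B)^*=(N^*,M^*;B,A),\] where the right side is the principal sum of $N^*$ (on $T$) and $M^*$ (on $S$) with respect to $B\subseteq T$ and $A\subseteq S$.
   Context: For matroids $M'$ on $S'$ and $N'$ on $T'$ with $S'\cap T'=\emptyset$, and $A'\subseteq S'$, $B'\subseteq T'$, the principal sum $(M',N';A',B')$ is the matroid union $M'^+(A',B')\vee N'_0$, where: $N'_0=N'\oplus U_{0,S'}$ ($N'$ with the elements of $S'$ added as loops); $M'^+(A',B')$ is the matroid on $S'\cup T'$ obtained from $M'$ by adding each element of $B'$ freely (by successive principal extensions) to the flat $\mathrm{cl}_{M'}(A')$ and each element of $T'-B'$ as a loop, equivalently the matroid with rank function $r(X\cup Y)=\min\{r_{M'}(X\cup A'),\,r_{M'}(X)+|Y\cap B'|\}$ for $X\subseteq S'$, $Y\subseteq T'$; and the matroid union $G\vee H$ of matroids on a common set has as independent sets the unions of an independent set of $G$ and an independent set of $H$. -}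

module Defs where

open import Data.Nat using (ℕ; zero; suc; _+_; _⊔_; _⊓_; _<_; _≡ᵇ_; _≤ᵇ_)
open import Data.Bool using (Bool; true; false; _∧_; _∨_; not; if_then_else_)
open import Data.Vec using (Vec; []; _∷_; _++_; splitAt; zipWith; foldr)
open import Data.List as List using (List)
open import Data.Fin using (Fin)
open import Data.Fin.Subset using (Subset; ⊥; ⊤; _∪_; _∩_; ∁; ∣_∣; _⊆_; _∈_; _∉_; ⁅_⁆)
open import Data.Product using (Σ; _×_; _,_; ∃-syntax)
open import Relation.Binary.PropositionalEquality using (_≡_)

-- Finite matroids are given by a (decidable, Bool-valued) independence
-- oracle on the subsets of a finite ground set Fin n.

IndepOracle : ℕ → Set
IndepOracle n = Subset n → Bool

record IsMatroid {n : ℕ} (I : IndepOracle n) : Set where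
  field
    indep-empty : I ⊥ ≡ true
    indep-down  : ∀ X Y → Y ⊆ X → I X ≡ true → I Y ≡ true
    indep-aug   : ∀ X Y → I X ≡ true → I Y ≡ true → ∣ X ∣ < ∣ Y ∣ →
                  ∃[ e ] (e ∈ Y × e ∉ X × I (X ∪ ⁅ e ⁆) ≡ true)

allSubsets : (n : ℕ) → List (Subset n)
allSubsets zero    = [] List.∷ List.[]
allSubsets (suc n) =
  List.map (true ∷_) (allSubsets n) List.++ List.map (false ∷_) (allSubsets n)

_⊆ᵇ_ : ∀ {n} → Subset n → Subset n → Bool
[]      ⊆ᵇ []      = true
(x ∷ X) ⊆ᵇ (y ∷ Y) = (not x ∨ y) ∧ (X ⊆ᵇ Y)

_=ᵇ_ : ∀ {n} → Subset n → Subset n → Bool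
X =ᵇ Y = (X ⊆ᵇ Y) ∧ (Y ⊆ᵇ X)

isEmptyᵇ : ∀ {n} → Subset n → Bool
isEmptyᵇ X = X ⊆ᵇ ⊥

anyᵇ : ∀ {n} → (Subset n → Bool) → Bool
anyᵇ {n} p = List.foldr (λ X b → p X ∨ b) false (allSubsets n)

rank : ∀ {n} → IndepOracle n → Subset n → ℕ
rank {n} I X =
  List.foldr (λ Y r → (if (Y ⊆ᵇ X) ∧ I Y then ∣ Y ∣ else 0) ⊔ r) 0 (allSubsets n)

isBasis : ∀ {n} → IndepOracle n → Subset n → Bool
isBasis I B = I B ∧ (∣ B ∣ ≡ᵇ rank I ⊤)

-- dual matroid M*: X is independent iff X is disjoint from some basis of M
-- (equivalently, the bases of M* are the complements of the bases of M)
dual : ∀ {n} → IndepOracle n → IndepOracle n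
dual I X = anyᵇ (λ B → isBasis I B ∧ isEmptyᵇ (B ∩ X))

-- Constructions on the ground set S ∪ T, with S = first m points and
-- T = last k points of Fin (m + k).  A subset of S ∪ T is X ++ Y.

rankPlus : ∀ {m k} → IndepOracle m → Subset m → Subset k → Subset (m + k) → ℕ
rankPlus {m} {k} I A B Z with splitAt m Z
... | X , Y , _ = rank I (X ∪ A) ⊓ (rank I X + ∣ Y ∩ B ∣)

principalExt : ∀ {m k} → IndepOracle m → Subset m → Subset k → IndepOracle (m + k)
principalExt I A B Z = rankPlus I A B Z ≡ᵇ ∣ Z ∣

-- N₀ = N ⊕ U_{0,S}: elements of S are loops
loopsThen : ∀ {m k} → IndepOracle k → IndepOracle (m + k)
loopsThen {m} J Z with splitAt m Z
... | X , Y , _ = isEmptyᵇ X ∧ J Y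

union : ∀ {n} → IndepOracle n → IndepOracle n → IndepOracle n
union G H Z = anyᵇ (λ Z₁ → anyᵇ (λ Z₂ → ((Z₁ ∪ Z₂) =ᵇ Z) ∧ G Z₁ ∧ H Z₂))

principalSum : ∀ {m k} → IndepOracle m → IndepOracle k →
               Subset m → Subset k → IndepOracle (m + k)
principalSum {m} I J A B = union (principalExt I A B) (loopsThen {m} J)

-- Both sides are Boolean oracles on the subsets X ++ Y of S ∪ T, so it suffices to show
-- that each of them holds exactly when X and Y satisfy the cobasis condition
--   T − Y spans N,   (S − X) ∪ A spans M,   and
--   r(M) + r(N) ≤ r_M(S − X) + |B − Y| + r_N(T − (Y ∪ B)).  For (M,N;A,B)* the condition follows
-- from these bounds applied to a basis avoiding X ++ Y, and conversely such a basis is built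
-- from bases of S − X and T − Y.  For (N*,M*;B,A) both directions reduce to the dual rank
-- formula.

module Submission where

open import Defs
open import Data.Bool using (Bool; true; false; _∧_; _∨_; not; if_then_else_)
open import Data.Bool.Properties using (T-≡)
open import Data.Empty using (⊥-elim)
open import Data.Fin using (Fin; zero)
open import Data.Fin.Subset
open import Data.Fin.Subset.Properties
  using ( drop-∷-⊆; s⊆s; ⊆-refl; ⊆-trans; ⊆-antisym; ⊥⊆; ⊆⊤; ∉⊥; ∣⊥∣≡0; ∣⁅x⁆∣≡1
        ; x∈⁅y⁆⇒x≡y; p⊆q⇒∣p∣≤∣q∣; p⊂q⇒∣p∣<∣q∣; ∣p∩q∣≤∣p∣; _∈?_
        ; p∩q⊆p; p∩q⊆q; x∈p∩q⁺; x∈p∩q⁻; p⊆p∪q; q⊆p∪q; x∈p∪q⁻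
        ; x∈∁p⇒x∉p; x∉p⇒x∈∁p; p⊆q⇒∁p⊇∁q; ∪-identityˡ; ∪-identityʳ )
open import Data.List as List using (List)
open import Data.List.Membership.Propositional using () renaming (_∈_ to _∈ₗ_)
open import Data.List.Membership.Propositional.Properties using (∈-map⁺; ∈-++⁺ˡ; ∈-++⁺ʳ)
import Data.List.Relation.Unary.Any as Any
open import Data.Nat using (ℕ; zero; suc; _+_; _∸_; _≤_; _⊓_; _⊔_; _≡ᵇ_; z≤n; s≤s⁻¹)
open import Data.Nat.Properties
open import Data.Product using (Σ-syntax; ∃-syntax; _×_; _,_; proj₁; proj₂)
open import Data.Sum using (_⊎_; inj₁; inj₂; [_,_]′)
open import Data.Vec using ([]; _∷_; _++_; splitAt; here; there)
open import Data.Vec.Properties using (map-++; zipWith-++; ++-injectiveˡ; ++-injectiveʳ)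
open import Function.Bundles using (Equivalence)
open import Relation.Nullary using (yes; no)
open import Relation.Binary.PropositionalEquality
  using (_≡_; refl; sym; trans; cong; cong₂; subst; subst₂; module ≡-Reasoning)

card-split : ∀ {n} (p q : Subset n) → ∣ p ∣ ≡ ∣ p ∩ q ∣ + ∣ p ∩ ∁ q ∣
card-split []          []          = refl
card-split (true  ∷ p) (true  ∷ q) = cong suc (card-split p q)
card-split (true  ∷ p) (false ∷ q) = trans (cong suc (card-split p q)) (sym (+-suc _ _))
card-split (false ∷ p) (_     ∷ q) = card-split p q

card-∪ : ∀ {n} (p q : Subset n) → ∣ p ∪ q ∣ ≡ ∣ p ∣ + ∣ ∁ p ∩ q ∣
card-∪ []          []          = refl
card-∪ (true  ∷ p) (_     ∷ q) = cong suc (card-∪ p q)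
card-∪ (false ∷ p) (true  ∷ q) = trans (cong suc (card-∪ p q)) (sym (+-suc _ _))
card-∪ (false ∷ p) (false ∷ q) = card-∪ p q

card-∪-≤ : ∀ {n} (p q : Subset n) → ∣ p ∪ q ∣ ≤ ∣ p ∣ + ∣ q ∣
card-∪-≤ p q =
  ≤-trans (≤-reflexive (card-∪ p q)) (+-monoʳ-≤ ∣ p ∣ (p⊆q⇒∣p∣≤∣q∣ (p∩q⊆q (∁ p) q)))

card-∪-disjoint : ∀ {n} (p q : Subset n) → q ⊆ ∁ p → ∣ p ∪ q ∣ ≡ ∣ p ∣ + ∣ q ∣
card-∪-disjoint p q q⊆∁p = trans (card-∪ p q) (cong (∣ p ∣ +_) (cong ∣_∣ ∁p∩q≡q))
  where
  ∁p∩q≡q : ∁ p ∩ q ≡ q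
  ∁p∩q≡q = ⊆-antisym (p∩q⊆q (∁ p) q) (λ x∈q → x∈p∩q⁺ (q⊆∁p x∈q , x∈q))

⁅⁆⊆ : ∀ {n} {e : Fin n} {U} → e ∈ U → ⁅ e ⁆ ⊆ U
⁅⁆⊆ {e = e} {U} e∈U x∈⁅e⁆ = subst (_∈ U) (sym (x∈⁅y⁆⇒x≡y e x∈⁅e⁆)) e∈U

card-insert : ∀ {n} (K : Subset n) (e : Fin n) → e ∉ K → ∣ K ∪ ⁅ e ⁆ ∣ ≡ suc ∣ K ∣
card-insert K e e∉K = begin
  ∣ K ∪ ⁅ e ⁆ ∣     ≡⟨ card-∪-disjoint K ⁅ e ⁆ (⁅⁆⊆ (x∉p⇒x∈∁p e∉K)) ⟩
  ∣ K ∣ + ∣ ⁅ e ⁆ ∣ ≡⟨ cong (∣ K ∣ +_) (∣⁅x⁆∣≡1 e) ⟩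
  ∣ K ∣ + 1         ≡⟨ +-comm ∣ K ∣ 1 ⟩
  suc ∣ K ∣         ∎
  where open ≡-Reasoning

card-≥⇒⊇ : ∀ {n} {p q : Subset n} → p ⊆ q → ∣ q ∣ ≤ ∣ p ∣ → q ⊆ p
card-≥⇒⊇ {p = p} p⊆q ∣q∣≤∣p∣ {x} x∈q with x ∈? p
... | yes x∈p = x∈p
... | no  x∉p = ⊥-elim (<⇒≱ (p⊂q⇒∣p∣<∣q∣ (p⊆q , x , x∈q , x∉p)) ∣q∣≤∣p∣)

subset-of-size : ∀ {n} (C : Subset n) d → d ≤ ∣ C ∣ → ∃[ D ] (D ⊆ C × ∣ D ∣ ≡ d)
subset-of-size {n} C zero _ = ⊥ , ⊥⊆ , ∣⊥∣≡0 n
subset-of-size (true ∷ C) (suc d) d<∣C∣ with subset-of-size C d (s≤s⁻¹ d<∣C∣)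
... | D , D⊆C , ∣D∣≡d = true ∷ D , s⊆s D⊆C , cong suc ∣D∣≡d
subset-of-size (false ∷ C) (suc d) d≤∣C∣ with subset-of-size C (suc d) d≤∣C∣
... | D , D⊆C , ∣D∣≡d = false ∷ D , s⊆s D⊆C , ∣D∣≡d

∪-least : ∀ {n} {p q r : Subset n} → p ⊆ r → q ⊆ r → p ∪ q ⊆ r
∪-least {p = p} {q} p⊆r q⊆r x∈p∪q = [ p⊆r , q⊆r ]′ (x∈p∪q⁻ p q x∈p∪q)

disjoint-card-≤ : ∀ {n} {p q r : Subset n} → p ⊆ r → q ⊆ r → q ⊆ ∁ p → ∣ p ∣ + ∣ q ∣ ≤ ∣ r ∣
disjoint-card-≤ {p = p} {q} {r} p⊆r q⊆r q⊆∁p =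
  subst (_≤ ∣ r ∣) (card-∪-disjoint p q q⊆∁p) (p⊆q⇒∣p∣≤∣q∣ (∪-least p⊆r q⊆r))

∁∩∁⊆∁∪ : ∀ {n} (p q : Subset n) → ∁ p ∩ ∁ q ⊆ ∁ (p ∪ q)
∁∩∁⊆∁∪ p q x∈∁p∩∁q with x∈p∩q⁻ (∁ p) (∁ q) x∈∁p∩∁q
... | x∈∁p , x∈∁q =
  x∉p⇒x∈∁p (λ x∈p∪q → [ x∈∁p⇒x∉p x∈∁p , x∈∁p⇒x∉p x∈∁q ]′ (x∈p∪q⁻ p q x∈p∪q))

∁⊆∁∪∪ : ∀ {n} {p q r : Subset n} → p ⊆ r → ∁ q ⊆ ∁ (p ∪ q) ∪ r
∁⊆∁∪∪ {p = p} {q} {r} p⊆r {x} x∈∁q with x ∈? p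
... | yes x∈p = q⊆p∪q (∁ (p ∪ q)) r (p⊆r x∈p)
... | no  x∉p = p⊆p∪q r (∁∩∁⊆∁∪ p q (x∈p∩q⁺ (x∉p⇒x∈∁p x∉p , x∈∁q)))

∪-rest : ∀ {n} (p q : Subset n) → p ⊆ q → p ∪ (q ∩ ∁ p) ≡ q
∪-rest p q p⊆q = ⊆-antisym (∪-least p⊆q (p∩q⊆p q (∁ p))) q⊆
  where
  q⊆ : q ⊆ p ∪ (q ∩ ∁ p)
  q⊆ {x} x∈q with x ∈? p
  ... | yes x∈p = p⊆p∪q (q ∩ ∁ p) x∈p
  ... | no  x∉p = q⊆p∪q p (q ∩ ∁ p) (x∈p∩q⁺ (x∈q , x∉p⇒x∈∁p x∉p))

-- Every subset of S ∪ T is X ++ Y.  (Kept opaque so that splitting Z does not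
-- disturb terms that compute with splitAt, such as the oracles of Defs.)
abstract
  ++-split : ∀ m {k} (Z : Subset (m + k)) → Σ[ X ∈ Subset m ] Σ[ Y ∈ Subset k ] (Z ≡ X ++ Y)
  ++-split m Z = splitAt m Z

splitAt-++ : ∀ m {k} (X : Subset m) (Y : Subset k) → splitAt m (X ++ Y) ≡ (X , Y , refl)
splitAt-++ zero    []      Y = refl
splitAt-++ (suc m) (x ∷ X) Y rewrite splitAt-++ m X Y = refl

card-++ : ∀ {m k} (X : Subset m) (Y : Subset k) → ∣ X ++ Y ∣ ≡ ∣ X ∣ + ∣ Y ∣
card-++ []          Y = refl
card-++ (true  ∷ X) Y = cong suc (card-++ X Y)
card-++ (false ∷ X) Y = card-++ X Y

∁-++ : ∀ {m k} (X : Subset m) (Y : Subset k) → ∁ (X ++ Y) ≡ ∁ X ++ ∁ Y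
∁-++ = map-++ not

∪-++ : ∀ {m k} (X X′ : Subset m) (Y Y′ : Subset k) → (X ++ Y) ∪ (X′ ++ Y′) ≡ (X ∪ X′) ++ (Y ∪ Y′)
∪-++ X X′ Y Y′ = zipWith-++ _∨_ X Y X′ Y′

⊤-++ : ∀ m {k} → ⊤ {m + k} ≡ ⊤ {m} ++ ⊤ {k}
⊤-++ zero    = refl
⊤-++ (suc m) = cong (true ∷_) (⊤-++ m)

zero-∈ : ∀ {n m b} {p : Subset n} {q : Subset m} → zero ∈ b ∷ p → zero ∈ b ∷ q
zero-∈ here = here

++-⊆ : ∀ {m k} {X X′ : Subset m} {Y Y′ : Subset k} → X ⊆ X′ → Y ⊆ Y′ → X ++ Y ⊆ X′ ++ Y′
++-⊆ {X = []}    {[]}     _     Y⊆Y′ x∈      = Y⊆Y′ x∈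
++-⊆ {X = _ ∷ _} {_ ∷ _} X⊆X′ _    here      = zero-∈ (X⊆X′ here)
++-⊆ {X = _ ∷ _} {_ ∷ _} X⊆X′ Y⊆Y′ (there x∈) = there (++-⊆ (drop-∷-⊆ X⊆X′) Y⊆Y′ x∈)

++-⊆⁻ : ∀ {m k} (X X′ : Subset m) {Y Y′ : Subset k} → X ++ Y ⊆ X′ ++ Y′ → X ⊆ X′ × Y ⊆ Y′
++-⊆⁻ []      []        XY⊆ = (λ ()) , XY⊆
++-⊆⁻ (_ ∷ X) (_ ∷ X′) XY⊆ with ++-⊆⁻ X X′ (drop-∷-⊆ XY⊆)
... | X⊆X′ , Y⊆Y′ = (λ { here → zero-∈ (XY⊆ here) ; (there x∈) → there (X⊆X′ x∈) }) , Y⊆Y′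

∧-true⁻ : ∀ {a b} → a ∧ b ≡ true → a ≡ true × b ≡ true
∧-true⁻ {true} {true} _ = refl , refl

∧-true⁺ : ∀ {a b} → a ≡ true → b ≡ true → a ∧ b ≡ true
∧-true⁺ refl refl = refl

bool-ext : ∀ {a b} → (a ≡ true → b ≡ true) → (b ≡ true → a ≡ true) → a ≡ b
bool-ext {true}  a⇒b _   = sym (a⇒b refl)
bool-ext {false} {true}  _ b⇒a = b⇒a refl
bool-ext {false} {false} _ _   = refl

≡ᵇ-true⁻ : ∀ {a b} → (a ≡ᵇ b) ≡ true → a ≡ b
≡ᵇ-true⁻ {a} {b} e = ≡ᵇ⇒≡ a b (Equivalence.from T-≡ e)

≡ᵇ-true⁺ : ∀ {a b} → a ≡ b → (a ≡ᵇ b) ≡ true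
≡ᵇ-true⁺ {a} {b} e = Equivalence.to T-≡ (≡⇒≡ᵇ a b e)

⊆ᵇ-true⁻ : ∀ {n} (X Y : Subset n) → (X ⊆ᵇ Y) ≡ true → X ⊆ Y
⊆ᵇ-true⁻ (true ∷ X) (true  ∷ Y) _  here = here
⊆ᵇ-true⁻ (true ∷ X) (false ∷ Y) () here
⊆ᵇ-true⁻ (x ∷ X) (y ∷ Y) e (there x∈X) = there (⊆ᵇ-true⁻ X Y (proj₂ (∧-true⁻ {not x ∨ y} e)) x∈X)

⊆ᵇ-true⁺ : ∀ {n} (X Y : Subset n) → X ⊆ Y → (X ⊆ᵇ Y) ≡ true
⊆ᵇ-true⁺ []          []          _   = refl
⊆ᵇ-true⁺ (true  ∷ X) (true  ∷ Y) X⊆Y = ⊆ᵇ-true⁺ X Y (drop-∷-⊆ X⊆Y)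
⊆ᵇ-true⁺ (true  ∷ X) (false ∷ Y) X⊆Y with X⊆Y here
... | ()
⊆ᵇ-true⁺ (false ∷ X) (_     ∷ Y) X⊆Y = ⊆ᵇ-true⁺ X Y (drop-∷-⊆ X⊆Y)

=ᵇ-true⁻ : ∀ {n} (X Y : Subset n) → (X =ᵇ Y) ≡ true → X ≡ Y
=ᵇ-true⁻ X Y e with ∧-true⁻ {X ⊆ᵇ Y} e
... | X⊆Y , Y⊆X = ⊆-antisym (⊆ᵇ-true⁻ X Y X⊆Y) (⊆ᵇ-true⁻ Y X Y⊆X)

=ᵇ-true⁺ : ∀ {n} {X Y : Subset n} → X ≡ Y → (X =ᵇ Y) ≡ true
=ᵇ-true⁺ {X = X} refl = ∧-true⁺ (⊆ᵇ-true⁺ X X ⊆-refl) (⊆ᵇ-true⁺ X X ⊆-refl)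

isEmptyᵇ-true⁻ : ∀ {n} (X : Subset n) → isEmptyᵇ X ≡ true → X ≡ ⊥
isEmptyᵇ-true⁻ X e = ⊆-antisym (⊆ᵇ-true⁻ X ⊥ e) ⊥⊆

isEmptyᵇ-⊥ : ∀ {n} → isEmptyᵇ (⊥ {n}) ≡ true
isEmptyᵇ-⊥ {n} = ⊆ᵇ-true⁺ (⊥ {n}) ⊥ ⊆-refl

disjointᵇ⁻ : ∀ {n} (D Z : Subset n) → isEmptyᵇ (D ∩ Z) ≡ true → D ⊆ ∁ Z
disjointᵇ⁻ D Z e x∈D = x∉p⇒x∈∁p (λ x∈Z → ∉⊥ (⊆ᵇ-true⁻ (D ∩ Z) ⊥ e (x∈p∩q⁺ (x∈D , x∈Z))))

disjointᵇ⁺ : ∀ {n} (D Z : Subset n) → D ⊆ ∁ Z → isEmptyᵇ (D ∩ Z) ≡ true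
disjointᵇ⁺ D Z D⊆∁Z = ⊆ᵇ-true⁺ (D ∩ Z) ⊥ avoid
  where
  avoid : D ∩ Z ⊆ ⊥
  avoid x∈D∩Z with x∈p∩q⁻ D Z x∈D∩Z
  ... | x∈D , x∈Z = ⊥-elim (x∈∁p⇒x∉p (D⊆∁Z x∈D) x∈Z)

allSubsets-complete : ∀ n (X : Subset n) → X ∈ₗ allSubsets n
allSubsets-complete zero    []          = Any.here refl
allSubsets-complete (suc n) (true  ∷ X) = ∈-++⁺ˡ (∈-map⁺ (true ∷_) (allSubsets-complete n X))
allSubsets-complete (suc n) (false ∷ X) = ∈-++⁺ʳ _ (∈-map⁺ (false ∷_) (allSubsets-complete n X))

anyᵇ-true⁻ : ∀ {n} (p : Subset n → Bool) → anyᵇ p ≡ true → ∃[ X ] (p X ≡ true)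
anyᵇ-true⁻ {n} p = go (allSubsets n)
  where
  go : ∀ Xs → List.foldr (λ X b → p X ∨ b) false Xs ≡ true → ∃[ X ] (p X ≡ true)
  go (X List.∷ Xs) e with p X in pX
  ... | true  = X , pX
  ... | false = go Xs e

anyᵇ-true⁺ : ∀ {n} (p : Subset n → Bool) (X : Subset n) → p X ≡ true → anyᵇ p ≡ true
anyᵇ-true⁺ {n} p X pX = go (allSubsets n) (allSubsets-complete n X)
  where
  go : ∀ Xs → X ∈ₗ Xs → List.foldr (λ X b → p X ∨ b) false Xs ≡ true
  go (Y List.∷ Xs) (Any.here refl) rewrite pX = refl
  go (Y List.∷ Xs) (Any.there X∈) with p Y
  ... | true  = refl
  ... | false = go Xs X∈

maxOver : ∀ {A : Set} → (A → ℕ) → List A → ℕ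
maxOver f = List.foldr (λ x r → f x ⊔ r) 0

maxOver-≥ : ∀ {A : Set} (f : A → ℕ) {x} xs → x ∈ₗ xs → f x ≤ maxOver f xs
maxOver-≥ f (y List.∷ xs) (Any.here refl) = m≤m⊔n (f y) _
maxOver-≥ f (y List.∷ xs) (Any.there x∈)  = ≤-trans (maxOver-≥ f xs x∈) (m≤n⊔m (f y) _)

maxOver-≤ : ∀ {A : Set} (f : A → ℕ) {c} xs → (∀ x → f x ≤ c) → maxOver f xs ≤ c
maxOver-≤ f List.[]         f≤c = z≤n
maxOver-≤ f (y List.∷ xs) f≤c = ⊔-lub (f≤c y) (maxOver-≤ f xs f≤c)

maxOver-attained : ∀ {A : Set} (f : A → ℕ) xs → maxOver f xs ≡ 0 ⊎ ∃[ x ] (maxOver f xs ≡ f x)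
maxOver-attained f List.[] = inj₁ refl
maxOver-attained f (y List.∷ xs) with ⊔-sel (f y) (maxOver f xs) | maxOver-attained f xs
... | inj₁ max≡fy | _                = inj₂ (y , max≡fy)
... | inj₂ max≡r  | inj₁ r≡0         = inj₁ (trans max≡r r≡0)
... | inj₂ max≡r  | inj₂ (x , r≡fx)  = inj₂ (x , trans max≡r r≡fx)

module _ {n : ℕ} (I : IndepOracle n) where

  candidate : Subset n → Subset n → ℕ
  candidate U K = if (K ⊆ᵇ U) ∧ I K then ∣ K ∣ else 0

  candidate-cases : ∀ U K → (K ⊆ U × I K ≡ true × candidate U K ≡ ∣ K ∣) ⊎ candidate U K ≡ 0
  candidate-cases U K with (K ⊆ᵇ U) in K⊆U | I K
  ... | true  | true  = inj₁ (⊆ᵇ-true⁻ K U K⊆U , refl , refl)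
  ... | true  | false = inj₂ refl
  ... | false | _     = inj₂ refl

  rank-≥ : ∀ U K → K ⊆ U → I K ≡ true → ∣ K ∣ ≤ rank I U
  rank-≥ U K K⊆U iK = subst (_≤ rank I U) candidate≡ (maxOver-≥ (candidate U) _ (allSubsets-complete n K))
    where
    candidate≡ : candidate U K ≡ ∣ K ∣
    candidate≡ rewrite ⊆ᵇ-true⁺ K U K⊆U | iK = refl

  rank-≤ : ∀ U {c} → (∀ K → K ⊆ U → I K ≡ true → ∣ K ∣ ≤ c) → rank I U ≤ c
  rank-≤ U {c} bound = maxOver-≤ (candidate U) (allSubsets n) candidate≤
    where
    candidate≤ : ∀ K → candidate U K ≤ c
    candidate≤ K with candidate-cases U K
    ... | inj₁ (K⊆U , iK , c≡) = subst (_≤ c) (sym c≡) (bound K K⊆U iK)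
    ... | inj₂ c≡0             = subst (_≤ c) (sym c≡0) z≤n

  rank-card : ∀ U → rank I U ≤ ∣ U ∣
  rank-card U = rank-≤ U (λ K K⊆U _ → p⊆q⇒∣p∣≤∣q∣ K⊆U)

  rank-indep : ∀ K → I K ≡ true → rank I K ≡ ∣ K ∣
  rank-indep K iK = ≤-antisym (rank-card K) (rank-≥ K K ⊆-refl iK)

  record BasisOf (U K : Subset n) : Set where
    constructor mkBasis
    field
      basis⊆      : K ⊆ U
      basis-indep : I K ≡ true
      basis-full  : rank I U ≤ ∣ K ∣
  open BasisOf public

  basis-card : ∀ {U K} → BasisOf U K → ∣ K ∣ ≡ rank I U
  basis-card {U} {K} (mkBasis K⊆U iK r≤∣K∣) = ≤-antisym (rank-≥ U K K⊆U iK) r≤∣K∣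

  basis-exists : I ⊥ ≡ true → ∀ U → ∃[ K ] BasisOf U K
  basis-exists i⊥ U with maxOver-attained (candidate U) (allSubsets n)
  ... | inj₁ r≡0      = ⊥ , mkBasis ⊥⊆ i⊥ (≤-reflexive (trans r≡0 (sym (∣⊥∣≡0 n))))
  ... | inj₂ (K , r≡) with candidate-cases U K
  ...   | inj₁ (K⊆U , iK , c≡) = K , mkBasis K⊆U iK (≤-reflexive (trans r≡ c≡))
  ...   | inj₂ c≡0             = ⊥ , mkBasis ⊥⊆ i⊥ (≤-reflexive (trans (trans r≡ c≡0) (sym (∣⊥∣≡0 n))))

  dual-true⁻ : ∀ Z → dual I Z ≡ true → ∃[ D ] (BasisOf ⊤ D × D ⊆ ∁ Z)
  dual-true⁻ Z e with anyᵇ-true⁻ _ e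
  ... | D , isBasis∧disjoint with ∧-true⁻ {isBasis I D} isBasis∧disjoint
  ... | isBasisD , disjoint with ∧-true⁻ {I D} isBasisD
  ... | iD , ∣D∣≡r = D , mkBasis ⊆⊤ iD (≤-reflexive (sym (≡ᵇ-true⁻ ∣D∣≡r))) , disjointᵇ⁻ D Z disjoint

  dual-true⁺ : ∀ Z D → BasisOf ⊤ D → D ⊆ ∁ Z → dual I Z ≡ true
  dual-true⁺ Z D basis D⊆∁Z = anyᵇ-true⁺ _ D
    (∧-true⁺ (∧-true⁺ (basis-indep basis) (≡ᵇ-true⁺ (basis-card basis))) (disjointᵇ⁺ D Z D⊆∁Z))

  record NestedBases (U V : Subset n) : Set where
    field
      inner outer : Subset n
      inner-basis : BasisOf U inner
      outer-basis : BasisOf V outer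
      inner⊆outer : inner ⊆ outer

module _ {n : ℕ} {I : IndepOracle n} (mat : IsMatroid I) where
  open IsMatroid mat
  open NestedBases

  rank-mono : ∀ {U V} → U ⊆ V → rank I U ≤ rank I V
  rank-mono {U} {V} U⊆V with basis-exists I indep-empty U
  ... | K , basis@(mkBasis K⊆U iK _) =
    subst (_≤ rank I V) (basis-card I basis) (rank-≥ I V K (⊆-trans K⊆U U⊆V) iK)

  -- Iterated augmentation: an independent subset K of U extends to a basis of U.
  -- The fuel f bounds the number of single-element augmentations still needed.
  extend-to-basis : ∀ U K → K ⊆ U → I K ≡ true → ∃[ K′ ] (K ⊆ K′ × BasisOf I U K′)
  extend-to-basis U K K⊆U iK = grow (rank I U) K K⊆U iK (m≤m+n (rank I U) ∣ K ∣)
    where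
    grow : ∀ f K → K ⊆ U → I K ≡ true → rank I U ≤ f + ∣ K ∣ → ∃[ K′ ] (K ⊆ K′ × BasisOf I U K′)
    grow zero K K⊆U iK r≤ = K , ⊆-refl , mkBasis K⊆U iK r≤
    grow (suc f) K K⊆U iK r≤ with rank I U ≤? ∣ K ∣
    ... | yes r≤∣K∣ = K , ⊆-refl , mkBasis K⊆U iK r≤∣K∣
    ... | no  r≰∣K∣ with basis-exists I indep-empty U
    ... | Kᵤ , mkBasis Kᵤ⊆U iKᵤ r≤∣Kᵤ∣ with indep-aug K Kᵤ iK iKᵤ (<-≤-trans (≰⇒> r≰∣K∣) r≤∣Kᵤ∣)
    ... | e , e∈Kᵤ , e∉K , iK+e with grow f (K ∪ ⁅ e ⁆) K+e⊆U iK+e r≤′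
      where
      K+e⊆U : K ∪ ⁅ e ⁆ ⊆ U
      K+e⊆U = ∪-least K⊆U (⁅⁆⊆ (Kᵤ⊆U e∈Kᵤ))
      r≤′ : rank I U ≤ f + ∣ K ∪ ⁅ e ⁆ ∣
      r≤′ = subst (rank I U ≤_) (sym (trans (cong (f +_) (card-insert K e e∉K)) (+-suc f ∣ K ∣))) r≤
    ... | K′ , K+e⊆K′ , basis = K′ , ⊆-trans (p⊆p∪q ⁅ e ⁆) K+e⊆K′ , basis

  rank-∪-≤ : ∀ U V → rank I (U ∪ V) ≤ rank I U + ∣ V ∣
  rank-∪-≤ U V = rank-≤ I (U ∪ V) bound
    where
    bound : ∀ W → W ⊆ U ∪ V → I W ≡ true → ∣ W ∣ ≤ rank I U + ∣ V ∣
    bound W W⊆U∪V iW = begin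
      ∣ W ∣                       ≡⟨ card-split W U ⟩
      ∣ W ∩ U ∣ + ∣ W ∩ ∁ U ∣     ≤⟨ +-mono-≤ (rank-≥ I U (W ∩ U) (p∩q⊆q W U) iW∩U) (p⊆q⇒∣p∣≤∣q∣ W∖U⊆V) ⟩
      rank I U + ∣ V ∣            ∎
      where
      open ≤-Reasoning
      iW∩U : I (W ∩ U) ≡ true
      iW∩U = indep-down W (W ∩ U) (p∩q⊆p W U) iW
      W∖U⊆V : W ∩ ∁ U ⊆ V
      W∖U⊆V x∈ with x∈p∩q⁻ W (∁ U) x∈
      ... | x∈W , x∈∁U with x∈p∪q⁻ U V (W⊆U∪V x∈W)
      ...   | inj₁ x∈U = ⊥-elim (x∈∁p⇒x∉p x∈∁U x∈U)
      ...   | inj₂ x∈V = x∈V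

  nestedBases : ∀ {U V} → U ⊆ V → NestedBases I U V
  nestedBases {U} {V} U⊆V with basis-exists I indep-empty U
  ... | K , basis@(mkBasis K⊆U iK _) with extend-to-basis V K (⊆-trans K⊆U U⊆V) iK
  ... | K′ , K⊆K′ , basis′ =
    record { inner = K ; outer = K′ ; inner-basis = basis ; outer-basis = basis′ ; inner⊆outer = K⊆K′ }

  -- The outer basis meets U only in the inner basis, which is maximal in U.
  outer∩⊆inner : ∀ {U V} (nb : NestedBases I U V) → outer nb ∩ U ⊆ inner nb
  outer∩⊆inner {U} nb = card-≥⇒⊇ inner⊆
    (≤-trans (rank-≥ I U _ (p∩q⊆q _ U) i∩) (basis-full (inner-basis nb)))
    where
    inner⊆ : inner nb ⊆ outer nb ∩ U
    inner⊆ x∈ = x∈p∩q⁺ (inner⊆outer nb x∈ , basis⊆ (inner-basis nb) x∈)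
    i∩ : I (outer nb ∩ U) ≡ true
    i∩ = indep-down (outer nb) _ (p∩q⊆p (outer nb) U) (basis-indep (outer-basis nb))

  dual-empty : dual I ⊥ ≡ true
  dual-empty with basis-exists I indep-empty ⊤
  ... | D , basis = dual-true⁺ I ⊥ D basis (λ _ → x∉p⇒x∈∁p ∉⊥)

  -- The dual rank formula r*(U) = |U| + r(S − U) − r(S), as two inequalities.
  dual-rank-≤ : ∀ U q → q ≤ rank (dual I) U → q + rank I ⊤ ≤ ∣ U ∣ + rank I (∁ U)
  dual-rank-≤ U q q≤r* with basis-exists (dual I) dual-empty U
  ... | W , mkBasis W⊆U dW r*≤∣W∣ with dual-true⁻ I W dW
  ... | D , mkBasis _ iD r≤∣D∣ , D⊆∁W = begin
    q + rank I ⊤                          ≤⟨ +-mono-≤ (≤-trans q≤r* r*≤∣W∣) r≤∣D∣ ⟩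
    ∣ W ∣ + ∣ D ∣                         ≡⟨ cong (∣ W ∣ +_) (card-split D U) ⟩
    ∣ W ∣ + (∣ D ∩ U ∣ + ∣ D ∩ ∁ U ∣)     ≡⟨ +-assoc ∣ W ∣ _ _ ⟨
    ∣ W ∣ + ∣ D ∩ U ∣ + ∣ D ∩ ∁ U ∣       ≤⟨ +-mono-≤ (disjoint-card-≤ W⊆U (p∩q⊆q D U) D∩U⊆∁W) D∖U-small ⟩
    ∣ U ∣ + rank I (∁ U)                  ∎
    where
    open ≤-Reasoning
    D∩U⊆∁W : D ∩ U ⊆ ∁ W
    D∩U⊆∁W x∈ = D⊆∁W (p∩q⊆p D U x∈)
    D∖U-small : ∣ D ∩ ∁ U ∣ ≤ rank I (∁ U)
    D∖U-small = rank-≥ I (∁ U) _ (p∩q⊆q D (∁ U)) (indep-down D _ (p∩q⊆p D (∁ U)) iD)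

  dual-rank-≥ : ∀ U q → q + rank I ⊤ ≤ ∣ U ∣ + rank I (∁ U) → q ≤ rank (dual I) U
  dual-rank-≥ U q bound = ≤-trans q≤∣W∣ (rank-≥ (dual I) U W (p∩q⊆p U (∁ D)) dW)
    where
    nb = nestedBases {∁ U} {⊤} ⊆⊤
    K = inner nb
    D = outer nb
    W = U ∩ ∁ D
    dW : dual I W ≡ true
    dW = dual-true⁺ I W D (outer-basis nb) (λ x∈D → x∉p⇒x∈∁p (λ x∈W → x∈∁p⇒x∉p (p∩q⊆q U (∁ D) x∈W) x∈D))
    K⊆∁[U∩D] : K ⊆ ∁ (U ∩ D)
    K⊆∁[U∩D] x∈K = x∉p⇒x∈∁p (λ x∈U∩D → x∈∁p⇒x∉p (basis⊆ (inner-basis nb) x∈K) (p∩q⊆p U D x∈U∩D))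
    q≤∣W∣ : q ≤ ∣ W ∣
    q≤∣W∣ = +-cancelʳ-≤ (rank I ⊤) q ∣ W ∣ (begin
      q + rank I ⊤
        ≤⟨ bound ⟩
      ∣ U ∣ + rank I (∁ U)
        ≡⟨ cong₂ _+_ (card-split U D) (sym (basis-card I (inner-basis nb))) ⟩
      ∣ U ∩ D ∣ + ∣ W ∣ + ∣ K ∣
        ≡⟨ cong (_+ ∣ K ∣) (+-comm ∣ U ∩ D ∣ ∣ W ∣) ⟩
      ∣ W ∣ + ∣ U ∩ D ∣ + ∣ K ∣
        ≡⟨ +-assoc ∣ W ∣ _ _ ⟩
      ∣ W ∣ + (∣ U ∩ D ∣ + ∣ K ∣)
        ≤⟨ +-monoʳ-≤ ∣ W ∣ (disjoint-card-≤ (p∩q⊆q U D) (inner⊆outer nb) K⊆∁[U∩D]) ⟩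
      ∣ W ∣ + ∣ D ∣
        ≤⟨ +-monoʳ-≤ ∣ W ∣ (rank-≥ I ⊤ D ⊆⊤ (basis-indep (outer-basis nb))) ⟩
      ∣ W ∣ + rank I ⊤
        ∎)
      where open ≤-Reasoning

  dual-rank-full⁻ : ∀ Y → rank (dual I) Y ≡ ∣ Y ∣ → rank I ⊤ ≤ rank I (∁ Y)
  dual-rank-full⁻ Y r*≡ = +-cancelˡ-≤ ∣ Y ∣ _ _ (dual-rank-≤ Y ∣ Y ∣ (≤-reflexive (sym r*≡)))

  dual-rank-full⁺ : ∀ Y → rank I ⊤ ≤ rank I (∁ Y) → rank (dual I) Y ≡ ∣ Y ∣
  dual-rank-full⁺ Y spans = ≤-antisym (rank-card (dual I) Y) (dual-rank-≥ Y ∣ Y ∣ (+-monoʳ-≤ ∣ Y ∣ spans))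

  -- The dual rank formula for U = Y ∪ B, measured beyond |Y|.
  dual-rank-∪-≤ : ∀ Y B x → ∣ Y ∣ + x ≤ rank (dual I) (Y ∪ B) →
                  x + rank I ⊤ ≤ ∣ ∁ Y ∩ B ∣ + rank I (∁ (Y ∪ B))
  dual-rank-∪-≤ Y B x x≤ = +-cancelˡ-≤ ∣ Y ∣ _ _ (begin
    ∣ Y ∣ + (x + rank I ⊤)                          ≡⟨ +-assoc ∣ Y ∣ x _ ⟨
    ∣ Y ∣ + x + rank I ⊤                            ≤⟨ dual-rank-≤ (Y ∪ B) _ x≤ ⟩
    ∣ Y ∪ B ∣ + rank I (∁ (Y ∪ B))                  ≡⟨ cong (_+ rank I (∁ (Y ∪ B))) (card-∪ Y B) ⟩
    ∣ Y ∣ + ∣ ∁ Y ∩ B ∣ + rank I (∁ (Y ∪ B))        ≡⟨ +-assoc ∣ Y ∣ _ _ ⟩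
    ∣ Y ∣ + (∣ ∁ Y ∩ B ∣ + rank I (∁ (Y ∪ B)))      ∎)
    where open ≤-Reasoning

  dual-rank-∪-≥ : ∀ Y B x → x + rank I ⊤ ≤ ∣ ∁ Y ∩ B ∣ + rank I (∁ (Y ∪ B)) →
                  ∣ Y ∣ + x ≤ rank (dual I) (Y ∪ B)
  dual-rank-∪-≥ Y B x bound = dual-rank-≥ (Y ∪ B) _ (begin
    ∣ Y ∣ + x + rank I ⊤                            ≡⟨ +-assoc ∣ Y ∣ x _ ⟩
    ∣ Y ∣ + (x + rank I ⊤)                          ≤⟨ +-monoʳ-≤ ∣ Y ∣ bound ⟩
    ∣ Y ∣ + (∣ ∁ Y ∩ B ∣ + rank I (∁ (Y ∪ B)))      ≡⟨ +-assoc ∣ Y ∣ _ _ ⟨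
    ∣ Y ∣ + ∣ ∁ Y ∩ B ∣ + rank I (∁ (Y ∪ B))        ≡⟨ cong (_+ rank I (∁ (Y ∪ B))) (card-∪ Y B) ⟨
    ∣ Y ∪ B ∣ + rank I (∁ (Y ∪ B))                  ∎)
    where open ≤-Reasoning

⊓-tight : ∀ a b c x y → a ⊓ (b + c) ≡ x + y → b ≤ x → c ≤ y → x + y ≤ a × b ≡ x × c ≡ y
⊓-tight a b c x y min≡ b≤x c≤y = x+y≤a , b≡x , c≡y
  where
  x+y≤a : x + y ≤ a
  x+y≤a = subst (_≤ a) min≡ (m⊓n≤m a (b + c))
  x+y≤b+c : x + y ≤ b + c
  x+y≤b+c = subst (_≤ b + c) min≡ (m⊓n≤n a (b + c))
  b≡x : b ≡ x
  b≡x = ≤-antisym b≤x (+-cancelʳ-≤ y x b (≤-trans x+y≤b+c (+-monoʳ-≤ b c≤y)))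
  c≡y : c ≡ y
  c≡y = ≤-antisym c≤y (+-cancelˡ-≤ x y c (≤-trans x+y≤b+c (+-monoˡ-≤ c (≤-reflexive b≡x))))

union-true⁻ : ∀ {n} (G H : IndepOracle n) Z → union G H Z ≡ true →
              ∃[ Z₁ ] ∃[ Z₂ ] (Z₁ ∪ Z₂ ≡ Z × G Z₁ ≡ true × H Z₂ ≡ true)
union-true⁻ G H Z e with anyᵇ-true⁻ _ e
... | Z₁ , e₁ with anyᵇ-true⁻ _ e₁
... | Z₂ , e₂ with ∧-true⁻ {(Z₁ ∪ Z₂) =ᵇ Z} e₂
... | Z₁∪Z₂=Z , gh with ∧-true⁻ {G Z₁} gh
... | gZ₁ , hZ₂ = Z₁ , Z₂ , =ᵇ-true⁻ _ Z Z₁∪Z₂=Z , gZ₁ , hZ₂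

union-true⁺ : ∀ {n} (G H : IndepOracle n) {Z} Z₁ Z₂ → Z₁ ∪ Z₂ ≡ Z → G Z₁ ≡ true → H Z₂ ≡ true →
              union G H Z ≡ true
union-true⁺ G H Z₁ Z₂ Z₁∪Z₂≡Z gZ₁ hZ₂ =
  anyᵇ-true⁺ _ Z₁ (anyᵇ-true⁺ _ Z₂ (∧-true⁺ (=ᵇ-true⁺ Z₁∪Z₂≡Z) (∧-true⁺ gZ₁ hZ₂)))

module _ {m k : ℕ} (I : IndepOracle m) (J : IndepOracle k) (A : Subset m) (B : Subset k) where

  rankPlus-++ : ∀ X Y → rankPlus I A B (X ++ Y) ≡ rank I (X ∪ A) ⊓ (rank I X + ∣ Y ∩ B ∣)
  rankPlus-++ X Y rewrite splitAt-++ m X Y = refl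

  principalExt-true⁻ : ∀ X Y → principalExt I A B (X ++ Y) ≡ true →
                       rank I X ≡ ∣ X ∣ × Y ⊆ B × ∣ X ∣ + ∣ Y ∣ ≤ rank I (X ∪ A)
  principalExt-true⁻ X Y e with ⊓-tight _ _ _ _ _ rank≡ (rank-card I X) (∣p∩q∣≤∣p∣ Y B)
    where
    rank≡ : rank I (X ∪ A) ⊓ (rank I X + ∣ Y ∩ B ∣) ≡ ∣ X ∣ + ∣ Y ∣
    rank≡ = trans (sym (rankPlus-++ X Y)) (trans (≡ᵇ-true⁻ e) (card-++ X Y))
  ... | free , indep , ∣Y∩B∣≡∣Y∣ =
    indep , ⊆-trans (card-≥⇒⊇ (p∩q⊆p Y B) (≤-reflexive (sym ∣Y∩B∣≡∣Y∣))) (p∩q⊆q Y B) , free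

  principalExt-true⁺ : ∀ X Y → rank I X ≡ ∣ X ∣ → Y ⊆ B → ∣ X ∣ + ∣ Y ∣ ≤ rank I (X ∪ A) →
                       principalExt I A B (X ++ Y) ≡ true
  principalExt-true⁺ X Y indep Y⊆B free = ≡ᵇ-true⁺ (begin
    rankPlus I A B (X ++ Y)                         ≡⟨ rankPlus-++ X Y ⟩
    rank I (X ∪ A) ⊓ (rank I X + ∣ Y ∩ B ∣)         ≡⟨ cong₂ (λ r c → rank I (X ∪ A) ⊓ (r + c)) indep ∣Y∩B∣≡∣Y∣ ⟩
    rank I (X ∪ A) ⊓ (∣ X ∣ + ∣ Y ∣)                ≡⟨ m≥n⇒m⊓n≡n free ⟩
    ∣ X ∣ + ∣ Y ∣                                   ≡⟨ card-++ X Y ⟨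
    ∣ X ++ Y ∣                                      ∎)
    where
    open ≡-Reasoning
    ∣Y∩B∣≡∣Y∣ : ∣ Y ∩ B ∣ ≡ ∣ Y ∣
    ∣Y∩B∣≡∣Y∣ = cong ∣_∣ (⊆-antisym (p∩q⊆p Y B) (λ x∈Y → x∈p∩q⁺ (x∈Y , Y⊆B x∈Y)))

  loopsThen-++ : ∀ X Y → loopsThen {m} J (X ++ Y) ≡ isEmptyᵇ X ∧ J Y
  loopsThen-++ X Y rewrite splitAt-++ m X Y = refl

  loopsThen-true⁻ : ∀ X Y → loopsThen {m} J (X ++ Y) ≡ true → X ≡ ⊥ × J Y ≡ true
  loopsThen-true⁻ X Y e with ∧-true⁻ {isEmptyᵇ X} (trans (sym (loopsThen-++ X Y)) e)
  ... | X-empty , jY = isEmptyᵇ-true⁻ X X-empty , jY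

  loopsThen-true⁺ : ∀ Y → J Y ≡ true → loopsThen {m} J (⊥ ++ Y) ≡ true
  loopsThen-true⁺ Y jY = trans (loopsThen-++ ⊥ Y) (∧-true⁺ (isEmptyᵇ-⊥ {m}) jY)

  record SumShape (Z : Subset (m + k)) : Set where
    field
      first        : Subset m
      placed second : Subset k
      shape        : Z ≡ first ++ (placed ∪ second)
      first-indep  : rank I first ≡ ∣ first ∣
      placed⊆B     : placed ⊆ B
      placed-free  : ∣ first ∣ + ∣ placed ∣ ≤ rank I (first ∪ A)
      second-indep : J second ≡ true

  principalSum-true⁻ : ∀ Z → principalSum I J A B Z ≡ true → SumShape Z
  principalSum-true⁻ Z e with union-true⁻ (principalExt I A B) (loopsThen {m} J) Z e
  ... | Z₁ , Z₂ , Z₁∪Z₂≡Z , e₁ , e₂ with ++-split m Z₁ | ++-split m Z₂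
  ... | X , Y₁ , refl | X₂ , Y₂ , refl with loopsThen-true⁻ X₂ Y₂ e₂ | principalExt-true⁻ X Y₁ e₁
  ... | refl , jY₂ | indep , Y₁⊆B , free = record
    { first = X ; placed = Y₁ ; second = Y₂ ; shape = shape ; first-indep = indep
    ; placed⊆B = Y₁⊆B ; placed-free = free ; second-indep = jY₂ }
    where
    open ≡-Reasoning
    shape : Z ≡ X ++ (Y₁ ∪ Y₂)
    shape = begin
      Z                           ≡⟨ Z₁∪Z₂≡Z ⟨
      (X ++ Y₁) ∪ (⊥ ++ Y₂)       ≡⟨ ∪-++ X ⊥ Y₁ Y₂ ⟩
      (X ∪ ⊥) ++ (Y₁ ∪ Y₂)        ≡⟨ cong (_++ (Y₁ ∪ Y₂)) (∪-identityʳ X) ⟩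
      X ++ (Y₁ ∪ Y₂)              ∎

  principalSum-true⁺ : ∀ {Z} → SumShape Z → principalSum I J A B Z ≡ true
  principalSum-true⁺ {Z} s =
    union-true⁺ (principalExt I A B) (loopsThen {m} J) (first ++ placed) (⊥ ++ second) glue
      (principalExt-true⁺ first placed first-indep placed⊆B placed-free)
      (loopsThen-true⁺ second second-indep)
    where
    open SumShape s
    open ≡-Reasoning
    glue : (first ++ placed) ∪ (⊥ ++ second) ≡ Z
    glue = begin
      (first ++ placed) ∪ (⊥ ++ second)   ≡⟨ ∪-++ first ⊥ placed second ⟩
      (first ∪ ⊥) ++ (placed ∪ second)    ≡⟨ cong (_++ (placed ∪ second)) (∪-identityʳ first) ⟩
      first ++ (placed ∪ second)          ≡⟨ shape ⟨
      Z                                   ∎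

module _ {m k : ℕ} {M : IndepOracle m} {N : IndepOracle k} (matM : IsMatroid M) (matN : IsMatroid N)
         (A : Subset m) (B : Subset k) where

  principalSum-bound-span : ∀ {D U V} → principalSum M N A B D ≡ true → D ⊆ U ++ V →
                            ∣ D ∣ ≤ rank M (U ∪ A) + rank N V
  principalSum-bound-span {D} {U} {V} e D⊆ = begin
    ∣ D ∣                                      ≡⟨ trans (cong ∣_∣ shape) (card-++ first _) ⟩
    ∣ first ∣ + ∣ placed ∪ second ∣            ≤⟨ +-monoʳ-≤ ∣ first ∣ (card-∪-≤ placed second) ⟩
    ∣ first ∣ + (∣ placed ∣ + ∣ second ∣)      ≡⟨ +-assoc ∣ first ∣ _ _ ⟨
    ∣ first ∣ + ∣ placed ∣ + ∣ second ∣        ≤⟨ +-mono-≤ (≤-trans placed-free (rank-mono matM first∪A⊆))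
                                                            second-small ⟩
    rank M (U ∪ A) + rank N V                  ∎
    where
    open ≤-Reasoning
    open SumShape (principalSum-true⁻ M N A B D e)
    parts : first ⊆ U × placed ∪ second ⊆ V
    parts = ++-⊆⁻ first U (subst (_⊆ U ++ V) shape D⊆)
    first∪A⊆ : first ∪ A ⊆ U ∪ A
    first∪A⊆ = ∪-least (⊆-trans (proj₁ parts) (p⊆p∪q A)) (q⊆p∪q U A)
    second-small : ∣ second ∣ ≤ rank N V
    second-small = rank-≥ N V second (⊆-trans (q⊆p∪q placed second) (proj₂ parts)) second-indep

  principalSum-bound-B : ∀ {D U V} → principalSum M N A B D ≡ true → D ⊆ U ++ V →
                         ∣ D ∣ ≤ rank M U + (∣ V ∩ B ∣ + rank N (V ∩ ∁ B))
  principalSum-bound-B {D} {U} {V} e D⊆ = begin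
    ∣ D ∣                                            ≡⟨ trans (cong ∣_∣ shape) (card-++ first _) ⟩
    ∣ first ∣ + ∣ T′ ∣                               ≡⟨ cong₂ _+_ (sym first-indep) (card-split T′ B) ⟩
    rank M first + (∣ T′ ∩ B ∣ + ∣ T′ ∩ ∁ B ∣)       ≤⟨ +-mono-≤ (rank-mono matM (proj₁ parts))
                                                          (+-mono-≤ (p⊆q⇒∣p∣≤∣q∣ T′∩B⊆) T′∖B-small) ⟩
    rank M U + (∣ V ∩ B ∣ + rank N (V ∩ ∁ B))        ∎
    where
    open ≤-Reasoning
    open IsMatroid matN using (indep-down)
    open SumShape (principalSum-true⁻ M N A B D e)
    T′ : Subset k
    T′ = placed ∪ second
    parts : first ⊆ U × placed ∪ second ⊆ V
    parts = ++-⊆⁻ first U (subst (_⊆ U ++ V) shape D⊆)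
    T′∩B⊆ : T′ ∩ B ⊆ V ∩ B
    T′∩B⊆ x∈ with x∈p∩q⁻ T′ B x∈
    ... | x∈T′ , x∈B = x∈p∩q⁺ (proj₂ parts x∈T′ , x∈B)
    T′∖B⊆second : T′ ∩ ∁ B ⊆ second
    T′∖B⊆second x∈ with x∈p∩q⁻ T′ (∁ B) x∈
    ... | x∈T′ , x∈∁B with x∈p∪q⁻ placed second x∈T′
    ...   | inj₁ x∈placed = ⊥-elim (x∈∁p⇒x∉p x∈∁B (placed⊆B x∈placed))
    ...   | inj₂ x∈second = x∈second
    T′∖B-small : ∣ T′ ∩ ∁ B ∣ ≤ rank N (V ∩ ∁ B)
    T′∖B-small = rank-≥ N (V ∩ ∁ B) _
      (λ x∈ → x∈p∩q⁺ (proj₂ parts (p∩q⊆p T′ (∁ B) x∈) , p∩q⊆q T′ (∁ B) x∈))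
      (indep-down second _ T′∖B⊆second second-indep)

  principalSum-rank : rank (principalSum M N A B) ⊤ ≡ rank M ⊤ + rank N ⊤
  principalSum-rank = ≤-antisym upper lower
    where
    upper : rank (principalSum M N A B) ⊤ ≤ rank M ⊤ + rank N ⊤
    upper = rank-≤ _ ⊤ (λ D _ e → ≤-trans (principalSum-bound-span e (subst (D ⊆_) (⊤-++ m) ⊆⊤))
                                          (+-monoˡ-≤ (rank N ⊤) (rank-mono matM ⊆⊤)))
    lower : rank M ⊤ + rank N ⊤ ≤ rank (principalSum M N A B) ⊤
    lower with basis-exists M (IsMatroid.indep-empty matM) ⊤ | basis-exists N (IsMatroid.indep-empty matN) ⊤
    ... | KM , basisM@(mkBasis _ iKM _) | KN , basisN@(mkBasis _ iKN _) =
      subst (_≤ rank (principalSum M N A B) ⊤) size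
        (rank-≥ (principalSum M N A B) ⊤ (KM ++ (⊥ ∪ KN)) ⊆⊤ (principalSum-true⁺ M N A B bases))
      where
      free : ∣ KM ∣ + ∣ ⊥ {k} ∣ ≤ rank M (KM ∪ A)
      free = begin
        ∣ KM ∣ + ∣ ⊥ {k} ∣  ≡⟨ cong (∣ KM ∣ +_) (∣⊥∣≡0 k) ⟩
        ∣ KM ∣ + 0          ≡⟨ +-identityʳ ∣ KM ∣ ⟩
        ∣ KM ∣              ≡⟨ rank-indep M KM iKM ⟨
        rank M KM           ≤⟨ rank-mono matM (p⊆p∪q A) ⟩
        rank M (KM ∪ A)     ∎
        where open ≤-Reasoning
      bases : SumShape M N A B (KM ++ (⊥ ∪ KN))
      bases = record
        { first = KM ; placed = ⊥ ; second = KN ; shape = refl ; first-indep = rank-indep M KM iKM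
        ; placed⊆B = ⊥⊆ ; placed-free = free ; second-indep = iKN }
      size : ∣ KM ++ (⊥ ∪ KN) ∣ ≡ rank M ⊤ + rank N ⊤
      size = trans (card-++ KM (⊥ ∪ KN))
                   (cong₂ _+_ (basis-card M basisM) (trans (cong ∣_∣ (∪-identityˡ KN)) (basis-card N basisN)))

+-≤-parts : ∀ {p q p′ q′} → p + q ≤ p′ + q′ → p′ ≤ p → q′ ≤ q → p ≤ p′ × q ≤ q′
+-≤-parts {p} {q} {p′} {q′} h p′≤p q′≤q =
  +-cancelʳ-≤ q p p′ (≤-trans h (+-monoʳ-≤ p′ q′≤q)) , +-cancelˡ-≤ p q q′ (≤-trans h (+-monoˡ-≤ q′ p′≤p))

exchange-≤ : ∀ {x r s t a} → x + r ≤ s → s + t ≤ r + a → x + t ≤ a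
exchange-≤ {x} {r} {s} {t} {a} x+r≤s s+t≤r+a = +-cancelˡ-≤ r (x + t) a (begin
  r + (x + t)   ≡⟨ +-assoc r x t ⟨
  r + x + t     ≡⟨ cong (_+ t) (+-comm r x) ⟩
  x + r + t     ≤⟨ +-monoˡ-≤ t x+r≤s ⟩
  s + t         ≤⟨ s+t≤r+a ⟩
  r + a         ∎)
  where open ≤-Reasoning

spare-≤ : ∀ {s t r w c v} → s + t ≤ r + ((w + c) + v) → w + v ≤ t → s ≤ r + c
spare-≤ {s} {t} {r} {w} {c} {v} s+t≤ w+v≤t = +-cancelʳ-≤ t s (r + c) (begin
  s + t                 ≤⟨ s+t≤ ⟩
  r + ((w + c) + v)     ≡⟨ cong (λ u → r + (u + v)) (+-comm w c) ⟩
  r + ((c + w) + v)     ≡⟨ cong (r +_) (+-assoc c w v) ⟩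
  r + (c + (w + v))     ≡⟨ +-assoc r c (w + v) ⟨
  r + c + (w + v)       ≤⟨ +-monoʳ-≤ (r + c) w+v≤t ⟩
  r + c + t             ∎)
  where open ≤-Reasoning

module Coindependence {m k : ℕ} {M : IndepOracle m} {N : IndepOracle k}
                      (matM : IsMatroid M) (matN : IsMatroid N) (A : Subset m) (B : Subset k) where
  open NestedBases

  P : IndepOracle (m + k)
  P = principalSum M N A B

  Q : IndepOracle (k + m)
  Q = principalSum (dual N) (dual M) B A

  record CobasisCondition (X : Subset m) (Y : Subset k) : Set where
    field
      N-spans : rank N ⊤ ≤ rank N (∁ Y)
      M-spans : rank M ⊤ ≤ rank M (∁ X ∪ A)
      mixed   : rank M ⊤ + rank N ⊤ ≤ rank M (∁ X) + (∣ ∁ Y ∩ B ∣ + rank N (∁ (Y ∪ B)))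

  -- A basis of P inside (S − X) ++ (T − Y) is large enough to force the condition.
  coindependent⇒condition : ∀ X Y → dual P (X ++ Y) ≡ true → CobasisCondition X Y
  coindependent⇒condition X Y e with dual-true⁻ P (X ++ Y) e
  ... | D , mkBasis _ pD r≤∣D∣ , D⊆∁XY =
    record { N-spans = proj₂ spans ; M-spans = proj₁ spans ; mixed = mixed }
    where
    D⊆ : D ⊆ ∁ X ++ ∁ Y
    D⊆ = subst (D ⊆_) (∁-++ X Y) D⊆∁XY
    large : rank M ⊤ + rank N ⊤ ≤ ∣ D ∣
    large = subst (_≤ ∣ D ∣) (principalSum-rank matM matN A B) r≤∣D∣
    spans : rank M ⊤ ≤ rank M (∁ X ∪ A) × rank N ⊤ ≤ rank N (∁ Y)
    spans = +-≤-parts (≤-trans large (principalSum-bound-span matM matN A B pD D⊆))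
                      (rank-mono matM ⊆⊤) (rank-mono matN ⊆⊤)
    mixed : rank M ⊤ + rank N ⊤ ≤ rank M (∁ X) + (∣ ∁ Y ∩ B ∣ + rank N (∁ (Y ∪ B)))
    mixed = ≤-trans large (≤-trans (principalSum-bound-B matM matN A B pD D⊆)
              (+-monoʳ-≤ (rank M (∁ X)) (+-monoʳ-≤ ∣ ∁ Y ∩ B ∣ (rank-mono matN (∁∩∁⊆∁∪ Y B)))))

  -- Conversely, from the condition we build a basis of P avoiding X ++ Y: a basis K of S − X
  -- extended to a basis K′ of (S − X) ∪ A, a basis J of T − Y containing a basis L of
  -- T − (Y ∪ B), and r(M) − r_M(S − X) further elements D of (B − Y) − J, which P places
  -- freely on the span of A.
  module CobasisConstruction (X : Subset m) (Y : Subset k) (cond : CobasisCondition X Y) where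
    open CobasisCondition cond

    nbM : NestedBases M (∁ X) (∁ X ∪ A)
    nbM = nestedBases matM {∁ X} {∁ X ∪ A} (p⊆p∪q A)
    nbN : NestedBases N (∁ (Y ∪ B)) (∁ Y)
    nbN = nestedBases matN {∁ (Y ∪ B)} {∁ Y} (p⊆q⇒∁p⊇∁q (p⊆p∪q B))

    K K′ : Subset m
    L J  : Subset k
    K  = inner nbM
    K′ = outer nbM
    L  = inner nbN
    J  = outer nbN

    -- K spans S − X, so K′ adds nothing outside A.
    K′⊆K∪A : K′ ⊆ K ∪ A
    K′⊆K∪A {x} x∈K′ with x∈p∪q⁻ (∁ X) A (basis⊆ (outer-basis nbM) x∈K′)
    ... | inj₁ x∈∁X = p⊆p∪q A (outer∩⊆inner matM nbM (x∈p∩q⁺ (x∈K′ , x∈∁X)))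
    ... | inj₂ x∈A  = q⊆p∪q K A x∈A

    C : Subset k
    C = (∁ Y ∩ B) ∩ ∁ J

    -- The mixed condition leaves room for r(M) − r_M(S − X) elements in C.
    room : rank M ⊤ ∸ rank M (∁ X) ≤ ∣ C ∣
    room = m≤n+o⇒m∸n≤o (rank M ⊤) (rank M (∁ X))
      (spare-≤ {r = rank M (∁ X)} {∣ (∁ Y ∩ B) ∩ J ∣} {∣ C ∣} {rank N (∁ (Y ∪ B))} mixed′ J∩B+L≤)
      where
      open ≤-Reasoning
      mixed′ : rank M ⊤ + rank N ⊤ ≤ rank M (∁ X) + ((∣ (∁ Y ∩ B) ∩ J ∣ + ∣ C ∣) + rank N (∁ (Y ∪ B)))
      mixed′ = subst (λ u → _ ≤ rank M (∁ X) + (u + rank N (∁ (Y ∪ B)))) (card-split (∁ Y ∩ B) J) mixed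
      L⊆ : L ⊆ ∁ ((∁ Y ∩ B) ∩ J)
      L⊆ x∈L = x∉p⇒x∈∁p (λ x∈ → x∈∁p⇒x∉p (p⊆q⇒∁p⊇∁q (q⊆p∪q Y B) (basis⊆ (inner-basis nbN) x∈L))
                                           (p∩q⊆q (∁ Y) B (p∩q⊆p _ J x∈)))
      J∩B+L≤ : ∣ (∁ Y ∩ B) ∩ J ∣ + rank N (∁ (Y ∪ B)) ≤ rank N ⊤
      J∩B+L≤ = begin
        ∣ (∁ Y ∩ B) ∩ J ∣ + rank N (∁ (Y ∪ B))  ≡⟨ cong (∣ (∁ Y ∩ B) ∩ J ∣ +_) (basis-card N (inner-basis nbN)) ⟨
        ∣ (∁ Y ∩ B) ∩ J ∣ + ∣ L ∣               ≤⟨ disjoint-card-≤ (p∩q⊆q _ J) (inner⊆outer nbN) L⊆ ⟩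
        ∣ J ∣                                   ≤⟨ rank-≥ N ⊤ J ⊆⊤ (basis-indep (outer-basis nbN)) ⟩
        rank N ⊤                                ∎

    chosen : ∃[ D ] (D ⊆ C × ∣ D ∣ ≡ rank M ⊤ ∸ rank M (∁ X))
    chosen = subset-of-size C _ room

    D : Subset k
    D = proj₁ chosen

    D⊆C : D ⊆ C
    D⊆C = proj₁ (proj₂ chosen)

    K+D≡ : ∣ K ∣ + ∣ D ∣ ≡ rank M ⊤
    K+D≡ = trans (cong₂ _+_ (basis-card M (inner-basis nbM)) (proj₂ (proj₂ chosen)))
                 (m+[n∸m]≡n (rank-mono matM ⊆⊤))

    free : ∣ K ∣ + ∣ D ∣ ≤ rank M (K ∪ A)
    free = begin
      ∣ K ∣ + ∣ D ∣      ≡⟨ K+D≡ ⟩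
      rank M ⊤           ≤⟨ M-spans ⟩
      rank M (∁ X ∪ A)   ≤⟨ basis-full (outer-basis nbM) ⟩
      ∣ K′ ∣             ≤⟨ rank-≥ M (K ∪ A) K′ K′⊆K∪A (basis-indep (outer-basis nbM)) ⟩
      rank M (K ∪ A)     ∎
      where open ≤-Reasoning

    Z : Subset (m + k)
    Z = K ++ (D ∪ J)

    Z-indep : P Z ≡ true
    Z-indep = principalSum-true⁺ M N A B (record
      { first = K ; placed = D ; second = J ; shape = refl
      ; first-indep = rank-indep M K (basis-indep (inner-basis nbM))
      ; placed⊆B = λ x∈D → p∩q⊆q (∁ Y) B (p∩q⊆p _ (∁ J) (D⊆C x∈D))
      ; placed-free = free ; second-indep = basis-indep (outer-basis nbN) })

    J⊆∁D : J ⊆ ∁ D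
    J⊆∁D x∈J = x∉p⇒x∈∁p (λ x∈D → x∈∁p⇒x∉p (p∩q⊆q _ (∁ J) (D⊆C x∈D)) x∈J)

    Z-large : rank P ⊤ ≤ ∣ Z ∣
    Z-large = begin
      rank P ⊤                   ≡⟨ principalSum-rank matM matN A B ⟩
      rank M ⊤ + rank N ⊤        ≤⟨ +-monoʳ-≤ (rank M ⊤) (≤-trans N-spans (basis-full (outer-basis nbN))) ⟩
      rank M ⊤ + ∣ J ∣           ≡⟨ cong (_+ ∣ J ∣) K+D≡ ⟨
      ∣ K ∣ + ∣ D ∣ + ∣ J ∣      ≡⟨ +-assoc ∣ K ∣ _ _ ⟩
      ∣ K ∣ + (∣ D ∣ + ∣ J ∣)    ≡⟨ cong (∣ K ∣ +_) (card-∪-disjoint D J J⊆∁D) ⟨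
      ∣ K ∣ + ∣ D ∪ J ∣          ≡⟨ card-++ K (D ∪ J) ⟨
      ∣ Z ∣                      ∎
      where open ≤-Reasoning

    Z-avoids : Z ⊆ ∁ (X ++ Y)
    Z-avoids = subst (Z ⊆_) (sym (∁-++ X Y))
      (++-⊆ (basis⊆ (inner-basis nbM)) (∪-least (λ x∈D → p∩q⊆p (∁ Y) B (p∩q⊆p _ (∁ J) (D⊆C x∈D)))
                                                  (basis⊆ (outer-basis nbN))))

    coindependent : dual P (X ++ Y) ≡ true
    coindependent = dual-true⁺ P (X ++ Y) Z (mkBasis ⊆⊤ Z-indep Z-large) Z-avoids

  condition⇒coindependent : ∀ X Y → CobasisCondition X Y → dual P (X ++ Y) ≡ true
  condition⇒coindependent X Y cond = CobasisConstruction.coindependent X Y cond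

  shape-condition : ∀ {X₁ X₂ Y} → rank (dual N) Y ≡ ∣ Y ∣ → X₁ ⊆ A →
                    ∣ Y ∣ + ∣ X₁ ∣ ≤ rank (dual N) (Y ∪ B) → dual M X₂ ≡ true →
                    CobasisCondition (X₁ ∪ X₂) Y
  shape-condition {X₁} {X₂} {Y} Y-indep X₁⊆A free X₂-coindep = record
    { N-spans = dual-rank-full⁻ matN Y Y-indep
    ; M-spans = ≤-trans M-spans-∁X₂ (rank-mono matM (∁⊆∁∪∪ X₁⊆A))
    ; mixed   = mixed }
    where
    open ≤-Reasoning
    M-spans-∁X₂ : rank M ⊤ ≤ rank M (∁ X₂)
    M-spans-∁X₂ = dual-rank-full⁻ matM X₂ (rank-indep (dual M) X₂ X₂-coindep)
    mixed : rank M ⊤ + rank N ⊤ ≤ rank M (∁ (X₁ ∪ X₂)) + (∣ ∁ Y ∩ B ∣ + rank N (∁ (Y ∪ B)))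
    mixed = begin
      rank M ⊤ + rank N ⊤
        ≤⟨ +-monoˡ-≤ (rank N ⊤) (≤-trans M-spans-∁X₂ (rank-mono matM (∁⊆∁∪∪ ⊆-refl))) ⟩
      rank M (∁ (X₁ ∪ X₂) ∪ X₁) + rank N ⊤
        ≤⟨ +-monoˡ-≤ (rank N ⊤) (rank-∪-≤ matM (∁ (X₁ ∪ X₂)) X₁) ⟩
      rank M (∁ (X₁ ∪ X₂)) + ∣ X₁ ∣ + rank N ⊤
        ≡⟨ +-assoc (rank M (∁ (X₁ ∪ X₂))) _ _ ⟩
      rank M (∁ (X₁ ∪ X₂)) + (∣ X₁ ∣ + rank N ⊤)
        ≤⟨ +-monoʳ-≤ (rank M (∁ (X₁ ∪ X₂))) (dual-rank-∪-≤ matN Y B ∣ X₁ ∣ free) ⟩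
      rank M (∁ (X₁ ∪ X₂)) + (∣ ∁ Y ∩ B ∣ + rank N (∁ (Y ∪ B)))
        ∎

  sumIndependent⇒condition : ∀ X Y → Q (Y ++ X) ≡ true → CobasisCondition X Y
  sumIndependent⇒condition X Y e =
    subst₂ CobasisCondition (sym (++-injectiveʳ Y first shape)) (sym (++-injectiveˡ Y first shape))
      (shape-condition first-indep placed⊆B placed-free second-indep)
    where open SumShape (principalSum-true⁻ (dual N) (dual M) B A (Y ++ X) e)

  -- Conversely, take K ⊆ K′ as in the construction above: X splits into X₁ = K′ ∩ X ⊆ A,
  -- placed freely on the dual span of B, and X₂ = X − X₁, which avoids the basis K′ of M.
  condition⇒sumIndependent : ∀ X Y → CobasisCondition X Y → Q (Y ++ X) ≡ true
  condition⇒sumIndependent X Y cond =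
    subst (λ X′ → Q (Y ++ X′) ≡ true) (∪-rest X₁ X (p∩q⊆q K′ X))
      (principalSum-true⁺ (dual N) (dual M) B A (record
        { first = Y ; placed = X₁ ; second = X₂ ; shape = refl
        ; first-indep = dual-rank-full⁺ matN Y N-spans ; placed⊆B = X₁⊆A
        ; placed-free = dual-rank-∪-≥ matN Y B ∣ X₁ ∣ (exchange-≤ X₁+r≤ mixed)
        ; second-indep = dual-true⁺ M X₂ K′ K′-basis K′⊆∁X₂ }))
    where
    open CobasisCondition cond
    nb : NestedBases M (∁ X) (∁ X ∪ A)
    nb = nestedBases matM (p⊆p∪q A)
    K K′ X₁ X₂ : Subset m
    K  = inner nb
    K′ = outer nb
    X₁ = K′ ∩ X
    X₂ = X ∩ ∁ X₁
    iK′ : M K′ ≡ true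
    iK′ = basis-indep (outer-basis nb)
    -- (S − X) ∪ A spans M, so K′ is a basis of M.
    K′-basis : BasisOf M ⊤ K′
    K′-basis = mkBasis ⊆⊤ iK′ (≤-trans M-spans (basis-full (outer-basis nb)))
    X₁⊆A : X₁ ⊆ A
    X₁⊆A x∈X₁ with x∈p∩q⁻ K′ X x∈X₁
    ... | x∈K′ , x∈X with x∈p∪q⁻ (∁ X) A (basis⊆ (outer-basis nb) x∈K′)
    ...   | inj₁ x∈∁X = ⊥-elim (x∈∁p⇒x∉p x∈∁X x∈X)
    ...   | inj₂ x∈A  = x∈A
    K′⊆∁X₂ : K′ ⊆ ∁ X₂
    K′⊆∁X₂ x∈K′ = x∉p⇒x∈∁p (λ x∈X₂ → x∈∁p⇒x∉p (p∩q⊆q X (∁ X₁) x∈X₂) (x∈p∩q⁺ (x∈K′ , p∩q⊆p X (∁ X₁) x∈X₂)))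
    K⊆∁X₁ : K ⊆ ∁ X₁
    K⊆∁X₁ x∈K = x∉p⇒x∈∁p (λ x∈X₁ → x∈∁p⇒x∉p (basis⊆ (inner-basis nb) x∈K) (p∩q⊆q K′ X x∈X₁))
    X₁+r≤ : ∣ X₁ ∣ + rank M (∁ X) ≤ rank M ⊤
    X₁+r≤ = begin
      ∣ X₁ ∣ + rank M (∁ X)   ≡⟨ cong (∣ X₁ ∣ +_) (basis-card M (inner-basis nb)) ⟨
      ∣ X₁ ∣ + ∣ K ∣          ≤⟨ disjoint-card-≤ (p∩q⊆p K′ X) (inner⊆outer nb) K⊆∁X₁ ⟩
      ∣ K′ ∣                  ≤⟨ rank-≥ M ⊤ K′ ⊆⊤ iK′ ⟩
      rank M ⊤                ∎
      where open ≤-Reasoning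

theorem3p8 : (m k : ℕ) (M : IndepOracle m) (N : IndepOracle k) →
             IsMatroid M → IsMatroid N →
             (A : Subset m) (B : Subset k) →
             (X : Subset m) (Y : Subset k) →
             dual (principalSum M N A B) (X ++ Y)
               ≡ principalSum (dual N) (dual M) B A (Y ++ X)
theorem3p8 m k M N matM matN A B X Y =
  bool-ext (λ e → condition⇒sumIndependent X Y (coindependent⇒condition X Y e))
           (λ e → condition⇒coindependent X Y (sumIndependent⇒condition X Y e))
  where open Coindependence matM matN A B
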